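{- Let $n\ge1$. A standard permutation $\pi=\pi(1)\cdots\pi(2n)$ of $\{\pm1,\ldots,\pm n\}$ is sign-connected if and only if for all $1\le m<2n$ the sum $\pi(1)+\cdots+\pi(m)>0$.
   Context: A standard permutation of $\{\pm1,\ldots,\pm n\}$ is a word in which each element of $\{\pm1,\ldots,\pm n\}$ appears exactly once, such that for every $i$, $i$ occurs before $-i$, and the negative entries occur in the order $-1,-2,\ldots,-n$. A permutation $\pi$ of $\{\pm1,\ldots,\pm n\}$ is sign-connected if for every $1\le m<2n$ there is at least one $j\in\{1,\ldots,n\}$ with $|\{\pi(1),\ldots,\pi(m)\}\cap\{ -j,j\}|=1$. -}

module Defs where

open import Data.Nat using (ℕ; zero; suc; _≤_; _<_; _*_)
open import Data.Integer using (ℤ; +_; -[1+_]) renaming (_+_ to _+ℤ_)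
open import Data.Integer using () renaming (_<_ to _<ℤ_)
open import Data.Fin using (Fin; toℕ)
open import Data.List using (List; map; upTo; _++_; length; lookup; take; foldr)
open import Data.List.Membership.Propositional using (_∈_)
open import Data.List.Relation.Binary.Permutation.Propositional using (_↭_)
open import Data.Product using (_×_; ∃; ∃-syntax)
open import Data.Sum using (_⊎_)
open import Relation.Binary.PropositionalEquality using (_≡_)
open import Relation.Nullary using (¬_)

pos neg : ℕ → ℤ
pos i = + i
neg zero = + 0
neg (suc k) = -[1+ k ]

signedElems : ℕ → List ℤ
signedElems n = map (λ k → pos (suc k)) (upTo n) ++ map (λ k → neg (suc k)) (upTo n)

Before : List ℤ → ℤ → ℤ → Set
Before w a b = ∃[ p ] ∃[ q ] (toℕ {length w} p < toℕ q × lookup w p ≡ a × lookup w q ≡ b)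

IsStandardPerm : ℕ → List ℤ → Set
IsStandardPerm n w =
  (w ↭ signedElems n)
  × (∀ i → 1 ≤ i → i ≤ n → Before w (pos i) (neg i))
  × (∀ i j → 1 ≤ i → i < j → j ≤ n → Before w (neg i) (neg j))

ExactlyOneOf : List ℤ → ℕ → Set
ExactlyOneOf u j = (pos j ∈ u × ¬ (neg j ∈ u)) ⊎ (¬ (pos j ∈ u) × neg j ∈ u)

SignConnected : ℕ → List ℤ → Set
SignConnected n w =
  ∀ m → 1 ≤ m → m < 2 * n → ∃[ j ] (1 ≤ j × j ≤ n × ExactlyOneOf (take m w) j)

sumℤ : List ℤ → ℤ
sumℤ = foldr _+ℤ_ (+ 0)

PositivePrefixSums : ℕ → List ℤ → Set
PositivePrefixSums n w = ∀ m → 1 ≤ m → m < 2 * n → + 0 <ℤ sumℤ (take m w)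

module Submission where

open import Defs
open import Data.Nat using (ℕ; _≤_)
open import Data.Integer using (ℤ)
open import Data.List using (List)
open import Function.Bundles using (_⇔_)

open import Data.Nat using (zero; suc; _<_; _+_; _*_; z≤n; s≤s; _≟_; _<?_)
import Data.Nat.Properties as ℕ
open import Data.Integer using (+_; -[1+_]; _⊖_) renaming (_<_ to _<ℤ_)
import Data.Integer as ℤ
import Data.Integer.Properties as ℤ
open import Data.List using ([]; _∷_; map; upTo; take)
open import Data.List.Membership.Propositional using (_∈_; _∉_)
open import Data.List.Membership.Propositional.Properties using (∈-lookup; ∈-map⁻)
open import Data.List.Membership.DecPropositional ℤ._≟_ using (_∈?_)
open import Data.List.Relation.Unary.Any using (here; there)
open import Data.List.Relation.Unary.All as All using (All; _∷_)
import Data.List.Relation.Unary.All.Properties as All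
open import Data.List.Relation.Unary.AllPairs using (_∷_)
open import Data.List.Relation.Unary.Unique.Propositional using (Unique)
import Data.List.Relation.Unary.Unique.Propositional.Properties as Unique
open import Data.List.Relation.Binary.Permutation.Propositional using (_↭_; ↭-sym; ↭⇒↭ₛ)
open import Data.List.Relation.Binary.Permutation.Propositional.Properties using (All-resp-↭)
import Data.List.Relation.Binary.Permutation.Setoid.Properties as Perm
open import Data.Fin using () renaming (zero to fzero; suc to fsuc)
open import Data.Product using (_×_; _,_; ∃-syntax)
open import Data.Sum using (_⊎_; inj₁; inj₂)
open import Data.Empty using (⊥-elim)
open import Relation.Binary.PropositionalEquality
  using (_≡_; _≢_; refl; sym; trans; cong; cong₂; subst; subst₂; setoid; module ≡-Reasoning)
open import Relation.Nullary using (¬_; yes; no)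
open import Function.Bundles using (mk⇔; Equivalence)
import Function.Properties.Equivalence as ⇔
open import Algebra.Properties.CommutativeSemigroup ℕ.+-commutativeSemigroup
  using () renaming (x∙yz≈y∙xz to +-left-comm)

-- Write  occ x u  for the number of occurrences of x in u.
-- For any list u with entries in {±1,…,±n},
--     sum u  =  Σ_{j=1..n} j·occ(j,u)  −  Σ_{j=1..n} j·occ(−j,u).
-- If moreover u has no repeated entries and every −j in u is accompanied
-- by j (true for every prefix of a standard permutation, as j precedes −j),
-- then 0 ≤ occ(−j,u) ≤ occ(j,u) ≤ 1, with strict inequality exactly when
-- one of ±j lies in u.  A sum of termwise-dominated terms is strictly
-- smaller iff some term is, so  sum u > 0  iff  some j has exactly one of
-- ±j in u.  Applied to each prefix  take m π  this is the theorem.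

sumTo : (ℕ → ℕ) → ℕ → ℕ
sumTo f zero    = 0
sumTo f (suc n) = f (suc n) + sumTo f n

OnRange : ℕ → (ℕ → Set) → Set
OnRange n P = ∀ j → 1 ≤ j → j ≤ n → P j

shrink : ∀ {n P} → OnRange (suc n) P → OnRange n P
shrink h j 1≤j j≤n = h j 1≤j (ℕ.m≤n⇒m≤1+n j≤n)

sumTo-cong : ∀ {f g} n → OnRange n (λ j → f j ≡ g j) → sumTo f n ≡ sumTo g n
sumTo-cong zero    _  = refl
sumTo-cong (suc n) eq = cong₂ _+_ (eq (suc n) (s≤s z≤n) ℕ.≤-refl) (sumTo-cong n (shrink eq))

sumTo-mono : ∀ {f g} n → OnRange n (λ j → f j ≤ g j) → sumTo f n ≤ sumTo g n
sumTo-mono zero    _  = z≤n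
sumTo-mono (suc n) le = ℕ.+-mono-≤ (le (suc n) (s≤s z≤n) ℕ.≤-refl) (sumTo-mono n (shrink le))

sumTo-bump : ∀ {f h} c m n → 1 ≤ m → m ≤ n →
             (∀ j → j ≢ m → h j ≡ f j) → h m ≡ c + f m → sumTo h n ≡ c + sumTo f n
sumTo-bump c m zero (s≤s _) () _ _
sumTo-bump {f} {h} c m (suc n) 1≤m m≤1+n off at with suc n ≟ m
... | yes refl = begin
  h m + sumTo h n       ≡⟨ cong₂ _+_ at (sumTo-cong n (λ j _ j≤n → off j (ℕ.<⇒≢ (s≤s j≤n)))) ⟩
  (c + f m) + sumTo f n ≡⟨ ℕ.+-assoc c (f m) (sumTo f n) ⟩
  c + (f m + sumTo f n) ∎
  where open ≡-Reasoning
... | no 1+n≢m = begin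
  h (suc n) + sumTo h n       ≡⟨ cong₂ _+_ (off (suc n) 1+n≢m) (sumTo-bump c m n 1≤m m≤n off at) ⟩
  f (suc n) + (c + sumTo f n) ≡⟨ +-left-comm (f (suc n)) c (sumTo f n) ⟩
  c + (f (suc n) + sumTo f n) ∎
  where
  open ≡-Reasoning
  m≤n : m ≤ n
  m≤n = ℕ.≤-pred (ℕ.≤∧≢⇒< m≤1+n (λ e → 1+n≢m (sym e)))

sumTo-<⇔ : ∀ {f g} n → OnRange n (λ j → f j ≤ g j) →
           sumTo f n < sumTo g n ⇔ (∃[ j ] (1 ≤ j × j ≤ n × f j < g j))
sumTo-<⇔ {f} {g} n le = mk⇔ (witness n le) (strict n le)
  where
  witness : ∀ n → OnRange n (λ j → f j ≤ g j) →
            sumTo f n < sumTo g n → ∃[ j ] (1 ≤ j × j ≤ n × f j < g j)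
  witness zero    _  ()
  witness (suc n) le lt with f (suc n) <? g (suc n)
  ... | yes top< = suc n , s≤s z≤n , ℕ.≤-refl , top<
  ... | no  top≮ with witness n (shrink le) (ℕ.+-cancelˡ-< (g (suc n)) _ _ lt′)
    where
    top≡ : f (suc n) ≡ g (suc n)
    top≡ = ℕ.≤-antisym (le (suc n) (s≤s z≤n) ℕ.≤-refl) (ℕ.≮⇒≥ top≮)
    lt′ : g (suc n) + sumTo f n < g (suc n) + sumTo g n
    lt′ = subst (λ t → t + sumTo f n < g (suc n) + sumTo g n) top≡ lt
  ...   | j , 1≤j , j≤n , fj<gj = j , 1≤j , ℕ.m≤n⇒m≤1+n j≤n , fj<gj

  strict : ∀ n → OnRange n (λ j → f j ≤ g j) →
           ∃[ j ] (1 ≤ j × j ≤ n × f j < g j) → sumTo f n < sumTo g n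
  strict zero _ (_ , s≤s _ , () , _)
  strict (suc n) le (j , 1≤j , j≤1+n , fj<gj) with j ≟ suc n
  ... | yes refl = ℕ.+-mono-<-≤ fj<gj (sumTo-mono n (shrink le))
  ... | no  j≢1+n = ℕ.+-mono-≤-< (le (suc n) (s≤s z≤n) ℕ.≤-refl)
                      (strict n (shrink le) (j , 1≤j , ℕ.≤-pred (ℕ.≤∧≢⇒< j≤1+n j≢1+n) , fj<gj))

occ : ℤ → List ℤ → ℕ
occ x []      = 0
occ x (y ∷ u) with x ℤ.≟ y
... | yes _ = suc (occ x u)
... | no  _ = occ x u

occ-hit : ∀ x u → occ x (x ∷ u) ≡ suc (occ x u)
occ-hit x u with x ℤ.≟ x
... | yes _  = refl
... | no x≢x = ⊥-elim (x≢x refl)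

occ-miss : ∀ {x y} u → x ≢ y → occ x (y ∷ u) ≡ occ x u
occ-miss {x} {y} u x≢y with x ℤ.≟ y
... | yes x≡y = ⊥-elim (x≢y x≡y)
... | no  _   = refl

occ⇒∈ : ∀ x u → 0 < occ x u → x ∈ u
occ⇒∈ x (y ∷ u) 0<occ with x ℤ.≟ y
... | yes x≡y = here x≡y
... | no  _   = there (occ⇒∈ x u 0<occ)

∉⇒occ≡0 : ∀ {x} u → x ∉ u → occ x u ≡ 0
∉⇒occ≡0 {x} u x∉u with occ x u in eq
... | zero  = refl
... | suc _ = ⊥-elim (x∉u (occ⇒∈ x u (subst (0 <_) (sym eq) (s≤s z≤n))))

∈⇒occ≡1 : ∀ {x u} → Unique u → x ∈ u → occ x u ≡ 1
∈⇒occ≡1 {x} {y ∷ u} (y∉u ∷ _) (here refl) =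
  trans (occ-hit x u) (cong suc (∉⇒occ≡0 u (λ x∈u → All.lookup y∉u x∈u refl)))
∈⇒occ≡1 {x} {y ∷ u} (y∉u ∷ uniq) (there x∈u) with x ℤ.≟ y
... | yes refl = ⊥-elim (All.lookup y∉u x∈u refl)
... | no  _    = ∈⇒occ≡1 uniq x∈u

⊖-positive⇔ : ∀ m n → (+ 0 <ℤ m ⊖ n) ⇔ (n < m)
⊖-positive⇔ m n = mk⇔ to from
  where
  from : n < m → + 0 <ℤ m ⊖ n
  from n<m = subst (_<ℤ m ⊖ n) (ℤ.n⊖n≡0 n) (ℤ.⊖-monoˡ-< n n<m)
  to : + 0 <ℤ m ⊖ n → n < m
  to 0<m⊖n with n <? m
  ... | yes n<m = n<m
  ... | no  n≮m = ⊥-elim (ℤ.<-irrefl refl (ℤ.<-≤-trans 0<m⊖n m⊖n≤0))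
    where
    m⊖n≤0 : m ⊖ n ℤ.≤ + 0
    m⊖n≤0 = subst (m ⊖ n ℤ.≤_) (ℤ.n⊖n≡0 n) (ℤ.⊖-monoˡ-≤ n (ℕ.≮⇒≥ n≮m))

Signed : ℕ → ℤ → Set
Signed n x = ∃[ j ] (1 ≤ j × j ≤ n × (x ≡ pos j ⊎ x ≡ neg j))

weight : (ℕ → ℤ) → ℕ → List ℤ → ℕ
weight label n u = sumTo (λ j → j * occ (label j) u) n

pos-injective : ∀ {i j} → pos i ≡ pos j → i ≡ j
pos-injective refl = refl

neg-injective : ∀ {i j} → neg i ≡ neg j → i ≡ j
neg-injective {zero}  {zero}  _    = refl
neg-injective {suc _} {suc _} refl = refl

pos≢neg : ∀ i j → 1 ≤ j → pos i ≢ neg j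
pos≢neg i (suc j) _ ()

weight-[] : ∀ label n → weight label n [] ≡ 0
weight-[] label zero    = refl
weight-[] label (suc n) = cong₂ _+_ (ℕ.*-zeroʳ (suc n)) (weight-[] label n)

weight-hit : ∀ {label} → (∀ {i j} → label i ≡ label j → i ≡ j) →
             ∀ {m} n u → 1 ≤ m → m ≤ n → weight label n (label m ∷ u) ≡ m + weight label n u
weight-hit {label} injective {m} n u 1≤m m≤n = sumTo-bump m m n 1≤m m≤n off at
  where
  off : ∀ j → j ≢ m → j * occ (label j) (label m ∷ u) ≡ j * occ (label j) u
  off j j≢m = cong (j *_) (occ-miss u (λ e → j≢m (injective e)))
  at : m * occ (label m) (label m ∷ u) ≡ m + m * occ (label m) u
  at = trans (cong (m *_) (occ-hit (label m) u)) (ℕ.*-suc m _)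

weight-miss : ∀ {label x} n u → OnRange n (λ j → label j ≢ x) → weight label n (x ∷ u) ≡ weight label n u
weight-miss n u ≢x = sumTo-cong n (λ j 1≤j j≤n → cong (j *_) (occ-miss u (≢x j 1≤j j≤n)))

sum-decomposition : ∀ n u → All (Signed n) u → sumℤ u ≡ weight pos n u ⊖ weight neg n u
sum-decomposition n [] _ = sym (cong₂ _⊖_ (weight-[] pos n) (weight-[] neg n))
sum-decomposition n (x ∷ u) ((m , 1≤m , m≤n , inj₁ refl) ∷ signed) = begin
  pos m ℤ.+ sumℤ u         ≡⟨ cong (λ t → pos m ℤ.+ t) (sum-decomposition n u signed) ⟩
  pos m ℤ.+ (P ⊖ N)        ≡⟨ ℤ.distribʳ-⊖-+-pos m P N ⟩
  (m + P) ⊖ N              ≡⟨ cong₂ _⊖_ (sym (weight-hit pos-injective n u 1≤m m≤n))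
                                       (sym (weight-miss n u (λ j 1≤j _ e → pos≢neg m j 1≤j (sym e)))) ⟩
  weight pos n (pos m ∷ u) ⊖ weight neg n (pos m ∷ u) ∎
  where
  open ≡-Reasoning
  P = weight pos n u
  N = weight neg n u
sum-decomposition n (x ∷ u) ((suc k , 1≤m , m≤n , inj₂ refl) ∷ signed) = begin
  -[1+ k ] ℤ.+ sumℤ u      ≡⟨ cong (λ t → -[1+ k ] ℤ.+ t) (sum-decomposition n u signed) ⟩
  -[1+ k ] ℤ.+ (P ⊖ N)     ≡⟨ ℤ.distribʳ-⊖-+-neg k P N ⟩
  P ⊖ (suc k + N)          ≡⟨ cong₂ _⊖_ (sym (weight-miss n u (λ j _ _ e → pos≢neg j (suc k) 1≤m e)))
                                       (sym (weight-hit neg-injective n u 1≤m m≤n)) ⟩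
  weight pos n (neg (suc k) ∷ u) ⊖ weight neg n (neg (suc k) ∷ u) ∎
  where
  open ≡-Reasoning
  P = weight pos n u
  N = weight neg n u

NegativesPaired : List ℤ → Set
NegativesPaired u = ∀ j → neg j ∈ u → pos j ∈ u

occ≤1 : ∀ {x u} → Unique u → occ x u ≤ 1
occ≤1 {x} {u} uniq with x ∈? u
... | yes x∈u = ℕ.≤-reflexive (∈⇒occ≡1 uniq x∈u)
... | no  x∉u = subst (_≤ 1) (sym (∉⇒occ≡0 u x∉u)) z≤n

occ-neg≤occ-pos : ∀ {u} → Unique u → NegativesPaired u → ∀ j → occ (neg j) u ≤ occ (pos j) u
occ-neg≤occ-pos {u} uniq paired j with neg j ∈? u
... | yes −j∈u = ℕ.≤-trans (occ≤1 uniq) (ℕ.≤-reflexive (sym (∈⇒occ≡1 uniq (paired j −j∈u))))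
... | no  −j∉u = subst (_≤ occ (pos j) u) (sym (∉⇒occ≡0 u −j∉u)) z≤n

exactlyOne⇔occ< : ∀ {u} → Unique u → NegativesPaired u →
                  ∀ j → ExactlyOneOf u j ⇔ (occ (neg j) u < occ (pos j) u)
exactlyOne⇔occ< {u} uniq paired j = mk⇔ to from
  where
  to : ExactlyOneOf u j → occ (neg j) u < occ (pos j) u
  to (inj₁ (j∈u , −j∉u)) = subst₂ _<_ (sym (∉⇒occ≡0 u −j∉u)) (sym (∈⇒occ≡1 uniq j∈u)) (s≤s z≤n)
  to (inj₂ (j∉u , −j∈u)) = ⊥-elim (j∉u (paired j −j∈u))
  from : occ (neg j) u < occ (pos j) u → ExactlyOneOf u j
  from lt = inj₁ (occ⇒∈ (pos j) u (ℕ.≤-<-trans z≤n lt) , −j∉u)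
    where
    −j∉u : neg j ∉ u
    −j∉u −j∈u = ℕ.<-irrefl refl (ℕ.<-≤-trans (subst (_< occ (pos j) u) (∈⇒occ≡1 uniq −j∈u) lt) (occ≤1 uniq))

scale-<⇔ : ∀ j {a b} → 1 ≤ j → (a < b) ⇔ (j * a < j * b)
scale-<⇔ (suc k) _ = mk⇔ (ℕ.*-monoʳ-< (suc k)) (ℕ.*-cancelˡ-< (suc k) _ _)

-- Chain:  ∃ j. exactly one of ±j      ⇔  ∃ j. j·occ(−j) < j·occ(j)
--                                     ⇔  N < P           (termwise domination)
--                                     ⇔  0 < P ⊖ N  ⇔  0 < sum u.
exactlyOne⇔positiveSum : ∀ n u → Unique u → All (Signed n) u → NegativesPaired u →
                         (∃[ j ] (1 ≤ j × j ≤ n × ExactlyOneOf u j)) ⇔ (+ 0 <ℤ sumℤ u)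
exactlyOne⇔positiveSum n u uniq signed paired =
  ⇔.trans termwise (⇔.trans (⇔.sym (sumTo-<⇔ n dominated)) (⇔.trans (⇔.sym (⊖-positive⇔ P N)) decomposed))
  where
  P = weight pos n u
  N = weight neg n u
  dominated : OnRange n (λ j → j * occ (neg j) u ≤ j * occ (pos j) u)
  dominated j _ _ = ℕ.*-monoʳ-≤ j (occ-neg≤occ-pos uniq paired j)
  termwise : (∃[ j ] (1 ≤ j × j ≤ n × ExactlyOneOf u j)) ⇔
             (∃[ j ] (1 ≤ j × j ≤ n × j * occ (neg j) u < j * occ (pos j) u))
  termwise = mk⇔ (λ (j , 1≤j , j≤n , e) → j , 1≤j , j≤n , step j 1≤j .Equivalence.to e)
                 (λ (j , 1≤j , j≤n , lt) → j , 1≤j , j≤n , step j 1≤j .Equivalence.from lt)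
    where
    step : ∀ j → 1 ≤ j → ExactlyOneOf u j ⇔ (j * occ (neg j) u < j * occ (pos j) u)
    step j 1≤j = ⇔.trans (exactlyOne⇔occ< uniq paired j) (scale-<⇔ j 1≤j)
  decomposed : (+ 0 <ℤ P ⊖ N) ⇔ (+ 0 <ℤ sumℤ u)
  decomposed = subst (λ s → (+ 0 <ℤ P ⊖ N) ⇔ (+ 0 <ℤ s)) (sym (sum-decomposition n u signed)) ⇔.refl

signedElems-unique : ∀ n → Unique (signedElems n)
signedElems-unique n =
  Unique.++⁺ (Unique.map⁺ (λ e → ℕ.suc-injective (pos-injective e)) (Unique.upTo⁺ n))
             (Unique.map⁺ (λ e → ℕ.suc-injective (neg-injective e)) (Unique.upTo⁺ n))
             disjoint
  where
  disjoint : ∀ {x} → ¬ (x ∈ map (λ k → pos (suc k)) (upTo n) × x ∈ map (λ k → neg (suc k)) (upTo n))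
  disjoint (p , q) with ∈-map⁻ (λ k → pos (suc k)) p | ∈-map⁻ (λ k → neg (suc k)) q
  ... | _ , _ , refl | _ , _ , ()

signedElems-signed : ∀ n → All (Signed n) (signedElems n)
signedElems-signed n = All.++⁺ (All.map⁺ (All.map positive (All.all-upTo n)))
                               (All.map⁺ (All.map negative (All.all-upTo n)))
  where
  positive : ∀ {k} → k < n → Signed n (pos (suc k))
  positive k<n = _ , s≤s z≤n , k<n , inj₁ refl
  negative : ∀ {k} → k < n → Signed n (neg (suc k))
  negative k<n = _ , s≤s z≤n , k<n , inj₂ refl

permutation-unique : ∀ n {w} → w ↭ signedElems n → Unique w
permutation-unique n σ = Perm.Unique-resp-↭ (setoid ℤ) (↭⇒↭ₛ (↭-sym σ)) (signedElems-unique n)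

permutation-signed : ∀ n {w} → w ↭ signedElems n → All (Signed n) w
permutation-signed n σ = All-resp-↭ (↭-sym σ) (signedElems-signed n)

signed-neg-bound : ∀ {n k} → Signed n (neg (suc k)) → suc k ≤ n
signed-neg-bound (suc _ , _ , j≤n , inj₂ refl) = j≤n

before-prefix : ∀ {a b : ℤ} w m → Unique w → Before w a b → b ∈ take m w → a ∈ take m w
before-prefix (x ∷ w) (suc m) _ (fzero , _ , _ , a≡x , _) _ = here (sym a≡x)
before-prefix (x ∷ w) (suc m) (x∉w ∷ _) (fsuc p , fsuc q , s≤s p<q , a≡ , b≡) (here b≡x) =
  ⊥-elim (All.lookup x∉w (subst (_∈ w) (trans b≡ b≡x) (∈-lookup q)) refl)
before-prefix (x ∷ w) (suc m) (_ ∷ uniq) (fsuc p , fsuc q , s≤s p<q , a≡ , b≡) (there b∈) =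
  there (before-prefix w m uniq (p , q , p<q , a≡ , b≡) b∈)

-- Since j precedes −j, every prefix of a standard permutation is paired.
prefix-paired : ∀ {n π} → IsStandardPerm n π → ∀ m → NegativesPaired (take m π)
prefix-paired _ m zero −0∈prefix = −0∈prefix
prefix-paired {n} {π} (σ , before , _) m (suc k) −j∈prefix =
  before-prefix π m (permutation-unique n σ) (before (suc k) (s≤s z≤n) j≤n) −j∈prefix
  where
  j≤n : suc k ≤ n
  j≤n = signed-neg-bound (All.lookup (All.take⁺ m (permutation-signed n σ)) −j∈prefix)

lemma2p5 : (n : ℕ) → 1 ≤ n → (π : List ℤ) → IsStandardPerm n π →
    SignConnected n π ⇔ PositivePrefixSums n π
lemma2p5 n _ π std@(σ , _ , _) =
  mk⇔ (λ connected m 1≤m m<2n → prefix m .Equivalence.to (connected m 1≤m m<2n))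
      (λ positive m 1≤m m<2n → prefix m .Equivalence.from (positive m 1≤m m<2n))
  where
  prefix : ∀ m → (∃[ j ] (1 ≤ j × j ≤ n × ExactlyOneOf (take m π) j)) ⇔ (+ 0 <ℤ sumℤ (take m π))
  prefix m = exactlyOne⇔positiveSum n (take m π)
               (Unique.take⁺ m (permutation-unique n σ))
               (All.take⁺ m (permutation-signed n σ))
               (prefix-paired std m)
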